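{- If $K_n$ is the complete graph of order $n\ge 3$, then $mag^+(K_n)=n$.
   Context: For an oriented graph $\vec G$, two distinct vertices $x,y$ monitor an arc $a$ if $a$ lies on every shortest directed path from $x$ to $y$, or on every shortest directed path from $y$ to $x$. A monitoring arc-geodetic set (MAG-set) is a vertex set $M$ such that every arc is monitored by some pair of distinct vertices of $M$; $mag(\vec G)$ is the minimum size of an MAG-set. For an undirected graph $G$, $mag^+(G)$ is the maximum of $mag(\vec G)$ over all orientations $\vec G$ of $G$. -}

module Defs where

open import Data.Nat using (ℕ; zero; suc; _≤_; _<_)
open import Data.Bool using (Bool; true; false; not)
open import Data.Fin using (Fin)
open import Data.Fin.Subset using (Subset; _∈_; ∣_∣)
open import Data.Product using (Σ; _×_; ∃; ∃-syntax; _,_)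
open import Data.Sum using (_⊎_)
open import Relation.Nullary using (¬_)
open import Relation.Binary.PropositionalEquality using (_≡_; _≢_)

record OrientationKn (n : ℕ) : Set where
  field
    arc      : Fin n → Fin n → Bool
    irrefl   : ∀ i → arc i i ≡ false
    oriented : ∀ i j → i ≢ j → arc i j ≡ not (arc j i)
open OrientationKn public

module _ {n : ℕ} (G : OrientationKn n) where

  data Path : Fin n → Fin n → ℕ → Set where
    here : ∀ {x} → Path x x zero
    step : ∀ {x z y k} → arc G x z ≡ true → Path z y k → Path x y (suc k)

  data OnPath (u v : Fin n) : ∀ {x y k} → Path x y k → Set where
    now   : ∀ {y k} (a : arc G u v ≡ true) (p : Path v y k) → OnPath u v (step a p)
    later : ∀ {x z y k} (a : arc G x z ≡ true) {p : Path z y k} →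
            OnPath u v p → OnPath u v (step a p)

  IsShortest : ∀ {x y k} → Path x y k → Set
  IsShortest {x} {y} {k} _ = ∀ m → m < k → ¬ Path x y m

  -- The arc u → v lies on every shortest directed path from x to y
  -- (and y is reachable from x, so the condition is not vacuous).
  OnAllShortest : Fin n → Fin n → Fin n → Fin n → Set
  OnAllShortest x y u v =
    (Σ ℕ λ k → Σ (Path x y k) IsShortest) ×
    (∀ k (p : Path x y k) → IsShortest p → OnPath u v p)

  Monitors : Fin n → Fin n → Fin n → Fin n → Set
  Monitors x y u v = x ≢ y × (OnAllShortest x y u v ⊎ OnAllShortest y x u v)

  IsMAGSet : Subset n → Set
  IsMAGSet M = ∀ u v → arc G u v ≡ true →
    ∃[ x ] ∃[ y ] (x ∈ M × y ∈ M × Monitors x y u v)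

  IsMag : ℕ → Set
  IsMag m = (Σ (Subset n) λ M → (IsMAGSet M × ∣ M ∣ ≡ m)) × (∀ M → IsMAGSet M → m ≤ ∣ M ∣)

IsMagPlusKn : ℕ → ℕ → Set
IsMagPlusKn n m =
  (∀ (G : OrientationKn n) → ∃[ k ] (IsMag G k × k ≤ m)) ×
  (Σ (OrientationKn n) λ G → IsMag G m)

{-# OPTIONS --safe #-}
module Submission where

-- Every orientation has mag ≤ n: the whole vertex set is an MAG-set, since the arc u → v is the
-- unique shortest u–v path, so u and v monitor it. A minimum exists constructively because being
-- an MAG-set is decidable: a shortest walk has fewer than n arcs (pigeonhole), so distances and
-- "on every shortest path" are finite searches. The bound is attained by the transitive tournament
-- (i → j iff i < j): a walk from x to y forces the arc x → y, so a pair monitors only the arc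
-- between its two vertices, and every MAG-set must contain every vertex.

open import Defs
open import Data.Nat using (ℕ; zero; suc; _≤_; _<_; _+_; _∸_; s≤s)
import Data.Nat.Properties as ℕ
open import Data.Nat.Induction using (<-rec)
open import Data.Bool using (true; false; not)
import Data.Bool.Properties as Bool
open import Data.Fin as Fin using (Fin; toℕ; punchIn)
import Data.Fin.Properties as Fin
open import Data.Fin.Subset using (Subset; _∈_; ∣_∣; ⊤)
import Data.Fin.Subset.Properties as Subset
open import Data.Product using (Σ; _×_; ∃; ∃-syntax; _,_; proj₁; proj₂)
open import Data.Sum using (_⊎_; inj₁; inj₂; [_,_])
open import Function using (_∘_; id; case_of_; Equivalence)
open import Data.Empty using (⊥-elim)
open import Level using (Level)
open import Relation.Unary using (Pred; Decidable)
open import Relation.Nullary using (¬_; Dec; does; yes; no; contradiction)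
open import Relation.Nullary.Decidable using (_×-dec_; _⊎-dec_; _→-dec_; ¬?; map′; dec-true; dec-false)
open import Relation.Binary.PropositionalEquality using (_≡_; _≢_; refl; sym; trans; cong; subst; ≢-sym)
open import Relation.Binary using (tri<; tri≈; tri>)

private variable ℓ : Level

module _ {P : Pred ℕ ℓ} (P? : Decidable P) where

  Least : ℕ → Set ℓ
  Least m = P m × (∀ j → j < m → ¬ P j)

  least : ∀ {k} → P k → ∃ Least
  least {k} = <-rec (λ k → P k → ∃ Least) search k
    where
    search : ∀ k → (∀ {j} → j < k → P j → ∃ Least) → P k → ∃ Least
    search k below pk with ℕ.anyUpTo? P? k
    ... | yes (j , j<k , pj) = below j<k pj
    ... | no none = k , pk , λ j j<k pj → none (j , j<k , pj)

module _ {n} {P : Pred (Subset n) ℓ} (P? : Decidable P) where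

  minimum-size : ∀ {M₀} → P M₀ → ∃ λ k →
    ((Σ (Subset n) λ M → P M × ∣ M ∣ ≡ k) × (∀ M → P M → k ≤ ∣ M ∣)) × k ≤ ∣ M₀ ∣
  minimum-size {M₀} pM₀
    with least (λ k → Subset.anySubset? λ M → P? M ×-dec (∣ M ∣ ℕ.≟ k)) (M₀ , pM₀ , refl)
  ... | k , witness , minimal = k , (witness , k≤size) , k≤size M₀ pM₀
    where
    k≤size : ∀ M → P M → k ≤ ∣ M ∣
    k≤size M pM = ℕ.≮⇒≥ λ ∣M∣<k → minimal ∣ M ∣ ∣M∣<k (M , pM , refl)

module _ {n} (G : OrientationKn n) where

  arc⇒≢ : ∀ {u v} → arc G u v ≡ true → u ≢ v
  arc⇒≢ {u} uv refl with trans (sym uv) (irrefl G u)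
  ... | ()

  arc-or-reverse : ∀ {u v} → u ≢ v → arc G u v ≡ true ⊎ arc G v u ≡ true
  arc-or-reverse {u} {v} u≢v with arc G u v in uv
  ... | true  = inj₁ refl
  ... | false = inj₂ (trans (oriented G v u (≢-sym u≢v)) (cong not uv))

  path? : ∀ k x y → Dec (Path G x y k)
  path? zero x y with x Fin.≟ y
  ... | yes refl = yes here
  ... | no x≢y   = no λ { here → x≢y refl }
  path? (suc k) x y =
    map′ (λ { (z , xz , p) → step xz p }) (λ { (step xz p) → _ , xz , p })
      (Fin.any? λ z → (arc G x z Bool.≟ true) ×-dec path? k z y)

  vertex : ∀ {x y k} → Path G x y k → Fin (suc k) → Fin n
  vertex {x} p Fin.zero = x
  vertex (step _ p) (Fin.suc i) = vertex p i

  prefix : ∀ {x y k} (p : Path G x y k) (i : Fin (suc k)) → Path G x (vertex p i) (toℕ i)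
  prefix p Fin.zero = here
  prefix (step xz p) (Fin.suc i) = step xz (prefix p i)

  suffix : ∀ {x y k} (p : Path G x y k) (i : Fin (suc k)) → Path G (vertex p i) y (k ∸ toℕ i)
  suffix p Fin.zero = p
  suffix (step _ p) (Fin.suc i) = suffix p i

  _++_ : ∀ {x y z k l} → Path G x y k → Path G y z l → Path G x z (k + l)
  here ++ q = q
  step xw p ++ q = step xw (p ++ q)

  -- A walk through more than n vertices repeats one; cutting out the cycle shortens it.
  shortcut : ∀ {x y k} → n < suc k → Path G x y k → ∃ λ m → m < k × Path G x y m
  shortcut {y = y} {k} n<1+k p with Fin.pigeonhole n<1+k (vertex p)
  ... | i , j , i<j , same = toℕ i + (k ∸ toℕ j) , shorter ,
        prefix p i ++ subst (λ w → Path G w y (k ∸ toℕ j)) (sym same) (suffix p j)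
    where
    shorter : toℕ i + (k ∸ toℕ j) < k
    shorter = subst (toℕ i + (k ∸ toℕ j) <_) (ℕ.m+[n∸m]≡n (Fin.toℕ≤pred[n] j))
                (ℕ.+-monoˡ-< (k ∸ toℕ j) i<j)

  shortest-length< : ∀ {x y k} (p : Path G x y k) → IsShortest G p → k < n
  shortest-length< p sh with ℕ._<?_ _ n
  ... | yes k<n = k<n
  ... | no k≮n with shortcut (s≤s (ℕ.≮⇒≥ k≮n)) p
  ...   | m , m<k , q = contradiction q (sh m m<k)

  shortest-length-unique : ∀ {x y k l} {p : Path G x y k} {q : Path G x y l} →
                           IsShortest G p → IsShortest G q → k ≡ l
  shortest-length-unique {p = p} {q} shp shq =
    ℕ.≤-antisym (ℕ.≮⇒≥ λ l<k → shp _ l<k q) (ℕ.≮⇒≥ λ k<l → shq _ k<l p)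

  onPath-step⁻¹ : ∀ {u v x z y k} {xz : arc G x z ≡ true} {p : Path G z y k} →
                  OnPath G u v (step xz p) → (x ≡ u × z ≡ v) ⊎ OnPath G u v p
  onPath-step⁻¹ (now _ _)   = inj₁ (refl , refl)
  onPath-step⁻¹ (later _ o) = inj₂ o

  onAllPaths? : ∀ u v k x y → Dec (∀ (p : Path G x y k) → OnPath G u v p)
  onAllPaths? u v zero x y with x Fin.≟ y
  ... | yes refl = no λ all → case all here of λ ()
  ... | no x≢y = yes λ { here → contradiction refl x≢y }
  onAllPaths? u v (suc k) x y =
    map′ from to (Fin.all? λ z → (arc G x z Bool.≟ true) →-dec
                   (((x Fin.≟ u) ×-dec (z Fin.≟ v)) ⊎-dec onAllPaths? u v k z y))
    where
    FirstArcOrRest : Fin n → Set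
    FirstArcOrRest z = arc G x z ≡ true → (x ≡ u × z ≡ v) ⊎ (∀ (q : Path G z y k) → OnPath G u v q)
    from : (∀ z → FirstArcOrRest z) → ∀ (p : Path G x y (suc k)) → OnPath G u v p
    from first (step {z = z} xz q) with first z xz
    ... | inj₁ (refl , refl) = now xz q
    ... | inj₂ rest = later xz (rest q)
    to : (∀ (p : Path G x y (suc k)) → OnPath G u v p) → ∀ z → FirstArcOrRest z
    to all z xz with (x Fin.≟ u) ×-dec (z Fin.≟ v)
    ... | yes first = inj₁ first
    ... | no ¬first = inj₂ λ q → [ ⊥-elim ∘ ¬first , id ] (onPath-step⁻¹ (all (step xz q)))

  onAllShortest? : ∀ x y u v → Dec (OnAllShortest G x y u v)
  onAllShortest? x y u v with ℕ.anyUpTo? (λ k → path? k x y) n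
  ... | no unreachable = no λ ((_ , p , sh) , _) → unreachable (_ , shortest-length< p sh , p)
  ... | yes (_ , _ , p) with least (λ k → path? k x y) p
  ...   | d , shortest@(q , minimal) with onAllPaths? u v d x y
  ...     | no ¬all = no λ (_ , all) → ¬all λ p → all d p minimal
  ...     | yes all = yes ((d , shortest) , every)
    where
    every : ∀ k (p : Path G x y k) → IsShortest G p → OnPath G u v p
    every k p sh with shortest-length-unique {p = p} {q} sh minimal
    ... | refl = all p

  monitors? : ∀ x y u v → Dec (Monitors G x y u v)
  monitors? x y u v = ¬? (x Fin.≟ y) ×-dec (onAllShortest? x y u v ⊎-dec onAllShortest? y x u v)

  isMAGSet? : Decidable (IsMAGSet G)
  isMAGSet? M = Fin.all? λ u → Fin.all? λ v → (arc G u v Bool.≟ true) →-dec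
    (Fin.any? λ x → Fin.any? λ y → (x Subset.∈? M) ×-dec (y Subset.∈? M) ×-dec monitors? x y u v)

  edge-isShortest : ∀ {u v} (uv : arc G u v ≡ true) → IsShortest G (step uv here)
  edge-isShortest uv zero _ here = arc⇒≢ uv refl
  edge-isShortest uv (suc _) (s≤s ()) _

  edge-onAllShortest : ∀ {u v} → arc G u v ≡ true → OnAllShortest G u v u v
  edge-onAllShortest {u} {v} uv = (1 , step uv here , edge-isShortest uv) , every
    where
    onPath-length1 : (p : Path G u v 1) → OnPath G u v p
    onPath-length1 (step uv′ here) = now uv′ here
    every : ∀ k (p : Path G u v k) → IsShortest G p → OnPath G u v p
    every k p sh with shortest-length-unique {p = p} {step uv here} sh (edge-isShortest uv)
    ... | refl = onPath-length1 p

  onAllShortest-edge : ∀ {x y u v} → arc G x y ≡ true → OnAllShortest G x y u v → x ≡ u × y ≡ v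
  onAllShortest-edge xy (_ , all) with onPath-step⁻¹ (all 1 (step xy here) (edge-isShortest xy))
  ... | inj₁ ends = ends
  ... | inj₂ ()

  ⊤-isMAGSet : IsMAGSet G ⊤
  ⊤-isMAGSet u v uv = u , v , Subset.∈⊤ , Subset.∈⊤ , arc⇒≢ uv , inj₁ (edge-onAllShortest uv)

  mag-exists : ∃[ k ] (IsMag G k × k ≤ n)
  mag-exists with minimum-size isMAGSet? ⊤-isMAGSet
  ... | k , isMag , k≤∣⊤∣ = k , isMag , subst (k ≤_) (Subset.∣⊤∣≡n n) k≤∣⊤∣

transitive-tournament : ∀ n → OrientationKn n
transitive-tournament n = record
  { arc      = λ i j → does (i Fin.<? j)
  ; irrefl   = λ i → dec-false (i Fin.<? i) (Fin.<-irrefl refl)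
  ; oriented = oriented′
  }
  where
  oriented′ : ∀ i j → i ≢ j → does (i Fin.<? j) ≡ not (does (j Fin.<? i))
  oriented′ i j i≢j with Fin.<-cmp i j
  ... | tri< i<j _ j≮i = trans (dec-true (i Fin.<? j) i<j) (cong not (sym (dec-false (j Fin.<? i) j≮i)))
  ... | tri≈ _ i≡j _   = contradiction i≡j i≢j
  ... | tri> i≮j _ j<i = trans (dec-false (i Fin.<? j) i≮j) (cong not (sym (dec-true (j Fin.<? i) j<i)))

module TransitiveTournament (n : ℕ) where

  private
    T : OrientationKn n
    T = transitive-tournament n

  -- does (i Fin.<? j) computes to toℕ i <ᵇ toℕ j.
  arc⇒< : ∀ {i j} → arc T i j ≡ true → i Fin.< j
  arc⇒< {i} {j} ij = ℕ.<ᵇ⇒< (toℕ i) (toℕ j) (Equivalence.from Bool.T-≡ ij)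

  path⇒≤ : ∀ {x y k} → Path T x y k → x Fin.≤ y
  path⇒≤ here = ℕ.≤-refl
  path⇒≤ (step xz p) = ℕ.≤-trans (ℕ.<⇒≤ (arc⇒< xz)) (path⇒≤ p)

  path⇒arc : ∀ {x y k} → x ≢ y → Path T x y k → arc T x y ≡ true
  path⇒arc {x} {y} x≢y p = dec-true (x Fin.<? y) (Fin.≤∧≢⇒< (path⇒≤ p) x≢y)

  monitors⇒endpoints : ∀ {x y u v} → Monitors T x y u v → (x ≡ u × y ≡ v) ⊎ (y ≡ u × x ≡ v)
  monitors⇒endpoints (x≢y , inj₁ on@((_ , p , _) , _)) =
    inj₁ (onAllShortest-edge T (path⇒arc x≢y p) on)
  monitors⇒endpoints (x≢y , inj₂ on@((_ , p , _) , _)) =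
    inj₂ (onAllShortest-edge T (path⇒arc (≢-sym x≢y) p) on)

  isMAGSet⇒endpoints∈ : ∀ {M u v} → IsMAGSet T M → arc T u v ≡ true → u ∈ M × v ∈ M
  isMAGSet⇒endpoints∈ {u = u} {v} isMAG uv with isMAG u v uv
  ... | x , y , x∈M , y∈M , mon with monitors⇒endpoints mon
  ...   | inj₁ (refl , refl) = x∈M , y∈M
  ...   | inj₂ (refl , refl) = y∈M , x∈M

mag-transitive-tournament : ∀ n → IsMag (transitive-tournament (2 + n)) (2 + n)
mag-transitive-tournament n =
  (⊤ , ⊤-isMAGSet T , Subset.∣⊤∣≡n (2 + n)) ,
  λ M isMAG → subst (_≤ ∣ M ∣) (Subset.∣⊤∣≡n (2 + n))
                (Subset.p⊆q⇒∣p∣≤∣q∣ {p = ⊤} λ {w} _ → every-vertex∈ isMAG w)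
  where
  T : OrientationKn (2 + n)
  T = transitive-tournament (2 + n)
  open TransitiveTournament (2 + n)
  every-vertex∈ : ∀ {M} → IsMAGSet T M → ∀ w → w ∈ M
  every-vertex∈ isMAG w with arc-or-reverse T (≢-sym (Fin.punchInᵢ≢i w Fin.zero))
  ... | inj₁ out = proj₁ (isMAGSet⇒endpoints∈ {v = punchIn w Fin.zero} isMAG out)
  ... | inj₂ in′ = proj₂ (isMAGSet⇒endpoints∈ {u = punchIn w Fin.zero} isMAG in′)

magPlus-complete : ∀ n → IsMagPlusKn (2 + n) (2 + n)
magPlus-complete n = mag-exists , transitive-tournament (2 + n) , mag-transitive-tournament n

theorem6 : ∀ (n : ℕ) → 3 ≤ n → IsMagPlusKn n n
theorem6 (suc (suc n)) (s≤s (s≤s _)) = magPlus-complete n
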